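{- Let $n\geq 3$ and let $K_n$, $C_n$ and $W_n$ denote the complete graph, the cycle and the wheel on $n$ vertices, respectively. Then for every integer $k$ with $3\leq k\leq n$, $$px_k(K_n)=px_k(C_n)=px_k(W_n)=2.$$
   Context: All graphs are finite, simple, undirected and connected. An edge-coloring of a graph $G$ assigns colors to edges (adjacent edges may receive the same color). A tree $T$ in an edge-colored graph is a proper tree if any two adjacent edges of $T$ receive different colors. For $S\subseteq V(G)$, an $S$-tree is a tree in $G$ containing all vertices of $S$. For a graph $G$ of order $n$ and an integer $k$ with $2\leq k\leq n$, an edge-coloring of $G$ is a $k$-proper coloring if for every set $S$ of $k$ vertices of $G$ there is a proper $S$-tree in $G$. The $k$-proper index $px_k(G)$ of a nontrivial connected graph $G$ is the smallest number of colors in a $k$-proper coloring of $G$. -}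

module Defs where

open import Data.Nat using (ℕ; zero; suc; _≤_; _<_)
open import Data.Fin using (Fin; toℕ)
open import Data.Fin.Subset using (Subset; _∈_; ∣_∣)
open import Data.List using (List; []; _∷_; _++_; length)
open import Data.List.Relation.Unary.Linked using (Linked)
open import Data.List.Relation.Unary.Unique.Propositional using (Unique)
open import Data.Product using (Σ; _×_; ∃; ∃-syntax; _,_)
open import Data.Sum using (_⊎_)
open import Relation.Binary.PropositionalEquality using (_≡_; _≢_)
open import Relation.Nullary using (¬_)

Graph : ℕ → Set₁
Graph n = Fin n → Fin n → Set

K : (n : ℕ) → Graph n
K n u v = u ≢ v

CycRel : ℕ → ℕ → ℕ → ℕ → Set
CycRel lo hi a b = b ≡ suc a ⊎ a ≡ suc b ⊎ (a ≡ lo × b ≡ hi) ⊎ (b ≡ lo × a ≡ hi)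

C : (n : ℕ) → Graph n
C (suc m) u v = u ≢ v × CycRel 0 m (toℕ u) (toℕ v)
C zero u v = u ≢ v

-- Wheel W_n on n vertices: hub 0, rim 1,...,n-1 forming a cycle.
W : (n : ℕ) → Graph n
W (suc m) u v = u ≢ v × (toℕ u ≡ 0 ⊎ toℕ v ≡ 0 ⊎ CycRel 1 m (toℕ u) (toℕ v))
W zero u v = u ≢ v

data Walk {n : ℕ} (E : Fin n → Fin n → Set) : Fin n → Fin n → Set where
  here : ∀ {u} → Walk E u u
  step : ∀ {u v w} → E u v → Walk E v w → Walk E u w

HasCycle : {n : ℕ} → (Fin n → Fin n → Set) → Set
HasCycle E = Σ _ λ x → Σ (List _) λ xs →
  2 ≤ length xs × Unique (x ∷ xs) × Linked E (x ∷ xs ++ (x ∷ []))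

record Tree {n : ℕ} (G : Graph n) : Set₁ where
  field
    V : Fin n → Set
    E : Fin n → Fin n → Set
    E-sym : ∀ {u v} → E u v → E v u
    E⊆G : ∀ {u v} → E u v → G u v
    E-ends : ∀ {u v} → E u v → V u × V v
    V-nonempty : ∃ V
    connected : ∀ {u v} → V u → V v → Walk E u v
    acyclic : ¬ HasCycle E

Coloring : {n : ℕ} → Graph n → ℕ → Set
Coloring {n} G c = Σ (Fin n → Fin n → Fin c) λ col → ∀ {u v} → G u v → col u v ≡ col v u

ProperTree : {n : ℕ} {G : Graph n} {c : ℕ} → Coloring G c → Tree G → Set
ProperTree (col , _) T = ∀ {u v w} → E u v → E v w → u ≢ w → col u v ≢ col v w
  where open Tree T

IsSTree : {n : ℕ} {G : Graph n} → Subset n → Tree G → Set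
IsSTree S T = ∀ {v} → v ∈ S → Tree.V T v

IsKProper : {n : ℕ} {G : Graph n} {c : ℕ} → ℕ → Coloring G c → Set₁
IsKProper {n} {G} k col = (S : Subset n) → ∣ S ∣ ≡ k →
  Σ (Tree G) λ T → IsSTree S T × ProperTree col T

HasKProperColoring : {n : ℕ} → Graph n → ℕ → ℕ → Set₁
HasKProperColoring G k c = Σ (Coloring G c) (IsKProper k)

PxEq : {n : ℕ} → Graph n → ℕ → ℕ → Set₁
PxEq G k m = HasKProperColoring G k m × (∀ c → c < m → ¬ HasKProperColoring G k c)

-- Every graph G considered contains the Hamiltonian path 0 — 1 — ⋯ — (n−1).
-- Colouring each path edge {i, i+1} by the parity of i makes this path a
-- proper tree through all vertices, so two colours suffice for every k.
-- Conversely, with a single colour a proper tree cannot have two adjacent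
-- edges, so it has at most two vertices and misses some S with |S| ≥ 3.
module Submission where

open import Defs
open import Data.Nat using (ℕ; zero; suc; _≤_; _<_; _⊓_; s≤s)
open import Data.Nat.Properties using (≤-reflexive; <-trans; <-irrefl; 1+n≢n; suc-injective; m≤n⇒m⊓n≡m; n≤1+n; ⊓-comm)
open import Data.Fin using (Fin; toℕ; zero; suc; _≟_)
open import Data.Fin.Properties using (toℕ-injective)
open import Data.Fin.Subset using (Subset; inside; ∣_∣) renaming (⊥ to ∅)
open import Data.Fin.Subset.Properties using (∣⊥∣≡0)
open import Data.Vec using (_∷_; here; there)
open import Data.List using ([]; _∷_; _++_)
open import Data.List.Relation.Unary.All using (_∷_)
open import Data.List.Relation.Unary.AllPairs using (_∷_)
open import Data.List.Relation.Unary.Linked as Linked using (Linked; [-]; _∷_)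
open import Data.List.Relation.Unary.Unique.Propositional using (Unique)
open import Data.Product using (_×_; _,_; proj₁)
open import Data.Sum as Sum using (_⊎_; inj₁; inj₂; swap)
open import Data.Unit using (⊤; tt)
open import Data.Empty using (⊥; ⊥-elim)
open import Function using (flip; _∘_)
open import Relation.Binary using (Rel; _⇒_; Transitive)
open import Relation.Binary.PropositionalEquality
open import Relation.Nullary using (¬_; yes; no)

_++ʷ_ : ∀ {n} {E : Fin n → Fin n → Set} {u v w} → Walk E u v → Walk E v w → Walk E u w
here ++ʷ q = q
step e p ++ʷ q = step e (p ++ʷ q)

reverseʷ : ∀ {n} {E : Fin n → Fin n → Set} → (∀ {u v} → E u v → E v u) →
  ∀ {u v} → Walk E u v → Walk E v u
reverseʷ sym here = here
reverseʷ sym (step e p) = reverseʷ sym p ++ʷ step (sym e) here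

mapʷ : ∀ {m n} {E : Fin m → Fin m → Set} {F : Fin n → Fin n → Set} (f : Fin m → Fin n) →
  (∀ {u v} → E u v → F (f u) (f v)) → ∀ {u v} → Walk E u v → Walk F (f u) (f v)
mapʷ f hom here = here
mapʷ f hom (step e p) = step (hom e) (mapʷ f hom p)

_↗_ : ∀ {n} → Fin n → Fin n → Set
u ↗ v = toℕ v ≡ suc (toℕ u)

PathEdge : ∀ {n} → Fin n → Fin n → Set
PathEdge u v = u ↗ v ⊎ v ↗ u

PathEdge-sym : ∀ {n} {u v : Fin n} → PathEdge u v → PathEdge v u
PathEdge-sym = swap

PathEdge-irreflexive : ∀ {n} {u v : Fin n} → PathEdge u v → u ≢ v
PathEdge-irreflexive (inj₁ u↗u) refl = 1+n≢n (sym u↗u)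
PathEdge-irreflexive (inj₂ u↗u) refl = 1+n≢n (sym u↗u)

↗⇒< : ∀ {n} {u v : Fin n} → u ↗ v → toℕ u < toℕ v
↗⇒< u↗v = ≤-reflexive (sym u↗v)

predecessor-unique : ∀ {n} {u v w : Fin n} → u ↗ w → v ↗ w → u ≡ v
predecessor-unique u↗w v↗w = toℕ-injective (suc-injective (trans (sym u↗w) v↗w))

successor-unique : ∀ {n} {u v w : Fin n} → u ↗ v → u ↗ w → v ≡ w
successor-unique u↗v u↗w = toℕ-injective (trans u↗v (sym u↗w))

PathEdge-suc : ∀ {n} {u v : Fin n} → PathEdge u v → PathEdge (suc u) (suc v)
PathEdge-suc = Sum.map (cong suc) (cong suc)

walkFromZero : ∀ {m} (v : Fin (suc m)) → Walk PathEdge zero v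
walkFromZero zero = here
walkFromZero {suc m} (suc v) = step (inj₁ refl) (mapʷ suc PathEdge-suc (walkFromZero v))

path-connected : ∀ {m} (u v : Fin (suc m)) → Walk PathEdge u v
path-connected u v = reverseʷ PathEdge-sym (walkFromZero u) ++ʷ walkFromZero v

-- A simple walk that leaves p along R keeps following R, because the only
-- other neighbour of its current vertex is the one it just came from. It
-- therefore climbs in ≺ and can never come back to a vertex below it.
module Monotone {a ℓ r} {A : Set a} {R : Rel A ℓ} {_≺_ : Rel A r}
  (R-leftUnique : ∀ {x y z} → R x z → R y z → x ≡ y)
  (R⇒≺ : R ⇒ _≺_) (≺-trans : Transitive _≺_) (≺-irrefl : ∀ {x} → ¬ x ≺ x) where

  Adj : Rel A ℓ
  Adj x y = R x y ⊎ R y x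

  keepsDirection : ∀ {p q r} → R p q → p ≢ r → Adj q r → R q r
  keepsDirection Rpq p≢r (inj₁ Rqr) = Rqr
  keepsDirection Rpq p≢r (inj₂ Rrq) = ⊥-elim (p≢r (R-leftUnique Rpq Rrq))

  cannotReturn : ∀ {f p q r} rest → R p q → f ≺ q →
    Linked Adj (q ∷ r ∷ rest ++ f ∷ []) → Unique (p ∷ q ∷ r ∷ rest) → ⊥
  cannotReturn [] Rpq f≺q (qr ∷ inj₁ Rrf ∷ [-]) ((_ ∷ p≢r ∷ _) ∷ _) =
    ≺-irrefl (≺-trans f≺q (≺-trans (R⇒≺ (keepsDirection Rpq p≢r qr)) (R⇒≺ Rrf)))
  cannotReturn [] Rpq f≺q (qr ∷ inj₂ Rfr ∷ [-]) ((_ ∷ p≢r ∷ _) ∷ _) =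
    ≺-irrefl (subst (_≺ _) (R-leftUnique Rfr (keepsDirection Rpq p≢r qr)) f≺q)
  cannotReturn (_ ∷ rest) Rpq f≺q (qr ∷ linked) ((_ ∷ p≢r ∷ _) ∷ unique) =
    cannotReturn rest Rqr (≺-trans f≺q (R⇒≺ Rqr)) linked unique
    where Rqr = keepsDirection Rpq p≢r qr

PathEdge-acyclic : ∀ {n} → ¬ HasCycle (PathEdge {n})
PathEdge-acyclic (x , a ∷ b ∷ rest , _ , unique , inj₁ x↗a ∷ linked) =
  Ascending.cannotReturn rest x↗a (↗⇒< x↗a) linked unique
  where
  module Ascending = Monotone {R = _↗_} {_≺_ = λ u v → toℕ u < toℕ v}
    predecessor-unique ↗⇒< <-trans (<-irrefl refl)
PathEdge-acyclic (x , a ∷ b ∷ rest , _ , unique , inj₂ a↗x ∷ linked) =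
  Descending.cannotReturn rest a↗x (↗⇒< a↗x) (Linked.map swap linked) unique
  where
  module Descending = Monotone {R = flip _↗_} {_≺_ = λ u v → toℕ v < toℕ u}
    successor-unique ↗⇒< (λ u≻v v≻w → <-trans v≻w u≻v) (<-irrefl refl)
PathEdge-acyclic (x , [] , () , _)
PathEdge-acyclic (x , _ ∷ [] , s≤s () , _)

pathTree : ∀ {m} {G : Graph (suc m)} → PathEdge ⇒ G → Tree G
pathTree path⊆G = record
  { V = λ _ → ⊤
  ; E = PathEdge
  ; E-sym = PathEdge-sym
  ; E⊆G = path⊆G
  ; E-ends = λ _ → tt , tt
  ; V-nonempty = zero , tt
  ; connected = λ {u} {v} _ _ → path-connected u v
  ; acyclic = PathEdge-acyclic
  }

parity : ℕ → Fin 2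
parity zero = zero
parity (suc zero) = suc zero
parity (suc (suc n)) = parity n

parity-suc : ∀ n → parity (suc n) ≢ parity n
parity-suc zero ()
parity-suc (suc zero) ()
parity-suc (suc (suc n)) = parity-suc n

alternating : ∀ {n} → Fin n → Fin n → Fin 2
alternating u v = parity (toℕ u ⊓ toℕ v)

alternating-sym : ∀ {n} (u v : Fin n) → alternating u v ≡ alternating v u
alternating-sym u v = cong parity (⊓-comm (toℕ u) (toℕ v))

alternating-↗ : ∀ {n} {u v : Fin n} → u ↗ v → alternating u v ≡ parity (toℕ u)
alternating-↗ {u = u} u↗v rewrite u↗v = cong parity (m≤n⇒m⊓n≡m (n≤1+n (toℕ u)))

alternating-↙ : ∀ {n} {u v : Fin n} → v ↗ u → alternating u v ≡ parity (toℕ v)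
alternating-↙ {u = u} {v} v↗u = trans (alternating-sym u v) (alternating-↗ v↗u)

alternating-proper : ∀ {n} {u v w : Fin n} → PathEdge u v → PathEdge v w → u ≢ w →
  alternating u v ≢ alternating v w
alternating-proper {u = u} {v} {w} (inj₁ u↗v) (inj₁ v↗w) _ same = parity-suc (toℕ u) (begin
  parity (suc (toℕ u)) ≡⟨ cong parity u↗v ⟨
  parity (toℕ v)       ≡⟨ alternating-↗ v↗w ⟨
  alternating v w      ≡⟨ same ⟨
  alternating u v      ≡⟨ alternating-↗ u↗v ⟩
  parity (toℕ u)       ∎)
  where open ≡-Reasoning
alternating-proper (inj₁ u↗v) (inj₂ w↗v) u≢w _ = u≢w (predecessor-unique u↗v w↗v)
alternating-proper (inj₂ v↗u) (inj₁ v↗w) u≢w _ = u≢w (successor-unique v↗u v↗w)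
alternating-proper {u = u} {v} {w} (inj₂ v↗u) (inj₂ w↗v) _ same = parity-suc (toℕ w) (begin
  parity (suc (toℕ w)) ≡⟨ cong parity w↗v ⟨
  parity (toℕ v)       ≡⟨ alternating-↙ v↗u ⟨
  alternating u v      ≡⟨ same ⟩
  alternating v w      ≡⟨ alternating-↙ w↗v ⟩
  parity (toℕ w)       ∎)
  where open ≡-Reasoning

path-kProper : ∀ {m} {G : Graph (suc m)} → PathEdge ⇒ G → ∀ k → HasKProperColoring G k 2
path-kProper path⊆G k =
  (alternating , λ {u} {v} _ → alternating-sym u v) ,
  λ _ _ → pathTree path⊆G , (λ _ → tt) , alternating-proper

no-colouring₀ : ∀ {m} {G : Graph (suc m)} → ¬ Coloring G 0
no-colouring₀ (colour , _) with colour zero zero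
... | ()

Fin1-unique : (i j : Fin 1) → i ≡ j
Fin1-unique zero zero = refl

module ProperTree₁ {n} {G : Graph n} (χ : Coloring G 1) (T : Tree G) (proper : ProperTree χ T) where
  open Tree T

  backtracks : ∀ {u v w} → E u v → E v w → u ≡ w
  backtracks {u} {w = w} uv vw with u ≟ w
  ... | yes u≡w = u≡w
  ... | no u≢w = ⊥-elim (proper uv vw u≢w (Fin1-unique _ _))

  walk-length≤1 : ∀ {u w} → Walk E u w → w ≡ u ⊎ E u w
  walk-length≤1 here = inj₁ refl
  walk-length≤1 (step uv p) with walk-length≤1 p
  ... | inj₁ refl = inj₂ uv
  ... | inj₂ vw = inj₁ (sym (backtracks uv vw))

  adjacent : ∀ {u v} → V u → V v → u ≢ v → E u v
  adjacent Vu Vv u≢v with walk-length≤1 (connected Vu Vv)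
  ... | inj₁ v≡u = ⊥-elim (u≢v (sym v≡u))
  ... | inj₂ uv = uv

  at-most-two-vertices : ∀ {u v w} → V u → V v → V w → u ≢ v → u ≢ w → v ≡ w
  at-most-two-vertices Vu Vv Vw u≢v u≢w =
    backtracks (E-sym (adjacent Vu Vv u≢v)) (adjacent Vu Vw u≢w)

initialSegment : ∀ {n} k → k ≤ n → Subset n
initialSegment zero _ = ∅
initialSegment (suc k) (s≤s k≤n) = inside ∷ initialSegment k k≤n

∣initialSegment∣ : ∀ {n} k (k≤n : k ≤ n) → ∣ initialSegment k k≤n ∣ ≡ k
∣initialSegment∣ {n} zero _ = ∣⊥∣≡0 n
∣initialSegment∣ (suc k) (s≤s k≤n) = cong suc (∣initialSegment∣ k k≤n)

no-kProper₁ : ∀ {n} {G : Graph n} k → 3 ≤ k → k ≤ n → ¬ HasKProperColoring G k 1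
no-kProper₁ k (s≤s (s≤s (s≤s _))) k≤n@(s≤s (s≤s (s≤s _))) (χ , kProper)
  with kProper (initialSegment k k≤n) (∣initialSegment∣ k k≤n)
... | T , S⊆T , proper =
  1≢2 (at-most-two-vertices (S⊆T here) (S⊆T (there here)) (S⊆T (there (there here))) (λ ()) (λ ()))
  where
  open ProperTree₁ χ T proper
  1≢2 : suc zero ≢ suc (suc zero)
  1≢2 ()

PathEdge⇒CycRel : ∀ {n lo hi} {u v : Fin n} → PathEdge u v → CycRel lo hi (toℕ u) (toℕ v)
PathEdge⇒CycRel = Sum.map₂ inj₁

px≡2 : ∀ {m} {G : Graph (suc m)} → PathEdge ⇒ G → ∀ k → 3 ≤ k → k ≤ suc m → PxEq G k 2
px≡2 path⊆G k 3≤k k≤n = path-kProper path⊆G k , λ where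
  zero _ → no-colouring₀ ∘ proj₁
  (suc zero) _ → no-kProper₁ k 3≤k k≤n
  (suc (suc _)) (s≤s (s≤s ()))

theorem3p1 : (n : ℕ) → 3 ≤ n → (k : ℕ) → 3 ≤ k → k ≤ n →
    PxEq (K n) k 2 × PxEq (C n) k 2 × PxEq (W n) k 2
theorem3p1 (suc m) _ k 3≤k k≤n =
  px≡2 PathEdge-irreflexive k 3≤k k≤n ,
  px≡2 (λ e → PathEdge-irreflexive e , PathEdge⇒CycRel e) k 3≤k k≤n ,
  px≡2 (λ e → PathEdge-irreflexive e , inj₂ (inj₂ (PathEdge⇒CycRel e))) k 3≤k k≤n
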